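{- Let $\mathrm{M}$ be a loopless matroid of rank $d$ on $E=\{1,\ldots,n\}$, and let $\overline{\mathrm{M}}$ be the matroid on $\overline{E}=\{0,1,\ldots,n\}$ obtained by adding $0$ as a coloop. For every $d$-element subset $B\subseteq E$, \[ \deg\Big(\prod_{e\in B} y_e\Big)=\begin{cases}1 & \text{if } B \text{ is a basis of } \mathrm{M},\\ 0 & \text{otherwise.}\end{cases} \]
   Context: The Chow ring $A(\overline{\mathrm{M}})$ is the quotient of the polynomial ring $\mathbb{R}[x_{\overline{F}}]$, with one variable for each nonempty proper flat $\overline{F}$ of $\overline{\mathrm{M}}$, by the ideal generated by the linear forms $\sum_{e_1\in\overline{F}}x_{\overline{F}}-\sum_{e_2\in\overline{F}}x_{\overline{F}}$ for each pair of distinct $e_1,e_2\in\overline{E}$, and the monomials $x_{\overline{F}_1}x_{\overline{F}_2}$ for incomparable nonempty proper flats $\overline{F}_1,\overline{F}_2$. Its degree-$d$ part is one-dimensional, and $\deg: A^d(\overline{\mathrm{M}})\to\mathbb{R}$ is the linear isomorphism with $\deg(x_{\overline{F}_1}\cdots x_{\overline{F}_d})=1$ for every chain $\overline{F}_1\subsetneq\cdots\subsetneq\overline{F}_d$ of nonempty proper flats. For $e\in E$, $y_e=\sum x_{\overline{F}}$, the sum over all flats $\overline{F}$ of $\overline{\mathrm{M}}$ containing $0$ and not containing $e$.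
   Formalization: The Chow ring $A(\overline{\mathrm{M}})$ has rational rather than real coefficients, so the degree map takes values in ℚ. -}

module Defs where

open import Data.Nat as ℕ using (ℕ; zero; suc; _<_; _<ᵇ_; _⊔_)
open import Data.Bool using (Bool; true; false; _∧_; _∨_; not; T)
open import Data.Fin using (Fin; zero; suc)
open import Data.Fin.Subset using (Subset; _∈_; _∉_; _⊆_; _⊂_; ∣_∣; _∪_; ⁅_⁆; ⊤; ⊥; inside; outside)
open import Data.Vec using (Vec; []; _∷_; lookup)
open import Data.List as L using (List; []; _∷_; [_]; map; filter; concatMap; foldr; length; allFin)
open import Data.Bool.ListAction using (all; any)
open import Data.List.Relation.Unary.All using (All)
open import Data.List.Relation.Unary.Linked using (Linked)
open import Data.List.Relation.Binary.Permutation.Propositional using (_↭_)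
open import Data.Rational using (ℚ; 0ℚ; 1ℚ; _+_)
open import Data.Product using (Σ; ∃; _×_)
open import Relation.Nullary using (¬_)
open import Relation.Nullary.Decidable using (T?)
open import Relation.Binary.PropositionalEquality using (_≡_; _≢_)

allSubsets : (m : ℕ) → List (Subset m)
allSubsets zero    = [ [] ]
allSubsets (suc m) = concatMap (λ s → (inside ∷ s) ∷ (outside ∷ s) ∷ []) (allSubsets m)

_∈ᵇ_ : ∀ {m} → Fin m → Subset m → Bool
e ∈ᵇ S = lookup S e

_⊆ᵇ_ : ∀ {m} → Subset m → Subset m → Bool
_⊆ᵇ_ {m} S U = all (λ e → not (e ∈ᵇ S) ∨ (e ∈ᵇ U)) (allFin m)

select : ∀ {A : Set} → (A → Bool) → List A → List A
select p = filter (λ x → T? (p x))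

elements : ∀ {m} → Subset m → List (Fin m)
elements {m} S = select (λ e → e ∈ᵇ S) (allFin m)

sumℚ : List ℚ → ℚ
sumℚ = foldr _+_ 0ℚ

maxℕ : List ℕ → ℕ
maxℕ = foldr _⊔_ 0

record Matroid (m : ℕ) : Set where
  field
    indep     : Subset m → Bool
    indep-∅   : T (indep ⊥)
    indep-⊆   : ∀ I J → J ⊆ I → T (indep I) → T (indep J)
    indep-aug : ∀ I J → T (indep I) → T (indep J) → ∣ I ∣ < ∣ J ∣ →
                ∃ λ e → e ∈ J × e ∉ I × T (indep (I ∪ ⁅ e ⁆))
open Matroid public

rankOf : ∀ {m} → (Subset m → Bool) → Subset m → ℕ
rankOf {m} ind S = maxℕ (map ∣_∣ (select (λ I → (I ⊆ᵇ S) ∧ ind I) (allSubsets m)))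

isFlat : ∀ {m} → (Subset m → Bool) → Subset m → Bool
isFlat {m} ind F =
  all (λ e → (e ∈ᵇ F) ∨ (rankOf ind F <ᵇ rankOf ind (F ∪ ⁅ e ⁆))) (allFin m)

Loopless : ∀ {m} → Matroid m → Set
Loopless {m} M = ∀ (e : Fin m) → T (indep M ⁅ e ⁆)

IsBasis : ∀ {m} → Matroid m → Subset m → Set
IsBasis M B = T (indep M B) × (∀ e → e ∉ B → ¬ T (indep M (B ∪ ⁅ e ⁆)))

-- The matroid M̄ on Ē = {0,1,…,n} = Fin (suc n) obtained by adding 0
-- as a coloop: element 1..n of E is  suc e  in Ē.
-- A set is independent in M̄ iff its part in E is independent in M.

indepBar : ∀ {n} → (Subset n → Bool) → Subset (suc n) → Bool
indepBar ind (_ ∷ S) = ind S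

module ChowRing {n : ℕ} (M : Matroid n) where

  Ē-indep : Subset (suc n) → Bool
  Ē-indep = indepBar (indep M)

  -- nonempty proper flats of M̄ (the variables of A(M̄))
  isNPFlat : Subset (suc n) → Bool
  isNPFlat F = isFlat Ē-indep F ∧ any (λ e → e ∈ᵇ F) (allFin (suc n))
                                ∧ not (all (λ e → e ∈ᵇ F) (allFin (suc n)))

  NPFlats : List (Subset (suc n))
  NPFlats = select isNPFlat (allSubsets (suc n))

  -- A monomial of A(M̄) is a list of variables x_F (order irrelevant,
  -- enforced by symmetry of the functional below).
  Monomial : Set
  Monomial = List (Subset (suc n))

  AllNP : Monomial → Set
  AllNP = All (λ F → T (isNPFlat F))

  -- A linear functional on the degree-d homogeneous part of the
  -- polynomial ring ℚ[x_F], given by its values on monomials, which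
  -- vanishes on the degree-d part of the defining ideal of A(M̄) and
  -- takes value 1 on every chain monomial: this is exactly  deg ∘ π
  -- (π : ℚ[x_F]_d → A^d(M̄) the quotient map).
  record IsDeg (d : ℕ) (φ : Monomial → ℚ) : Set where
    field
      -- commutativity of the polynomial ring
      symm    : ∀ m m′ → m ↭ m′ → φ m ≡ φ m′
      incomp  : ∀ F G rest → AllNP (F ∷ G ∷ rest) → length (F ∷ G ∷ rest) ≡ d →
                ¬ (F ⊆ G) → ¬ (G ⊆ F) → φ (F ∷ G ∷ rest) ≡ 0ℚ
      linear  : ∀ rest → AllNP rest → suc (length rest) ≡ d →
                ∀ (e₁ e₂ : Fin (suc n)) → e₁ ≢ e₂ →
                sumℚ (map (λ F → φ (F ∷ rest)) (select (λ F → e₁ ∈ᵇ F) NPFlats))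
                  ≡ sumℚ (map (λ F → φ (F ∷ rest)) (select (λ F → e₂ ∈ᵇ F) NPFlats))
      chain   : ∀ m → AllNP m → length m ≡ d → Linked _⊂_ m → φ m ≡ 1ℚ

  -- the variables appearing in y_e, e ∈ E (i.e. suc e in Ē):
  -- flats of M̄ containing 0 and not containing e
  yFlats : Fin n → List (Subset (suc n))
  yFlats e = select (λ F → isFlat Ē-indep F ∧ (zero ∈ᵇ F) ∧ not (suc e ∈ᵇ F))
                    (allSubsets (suc n))

  choices : ∀ {A : Set} → List (List A) → List (List A)
  choices []         = [ [] ]
  choices (xs ∷ xss) = concatMap (λ x → map (x ∷_) (choices xss)) xs

  -- φ applied to  ∏_{e ∈ B} y_e  (expanded into monomials, by linearity)
  degProdY : (Monomial → ℚ) → Subset n → ℚ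
  degProdY φ B = sumℚ (map φ (choices (map yFlats (elements B))))

-- Expanding ∏_{b ∈ B} y_b, the linear relation for 0 and b replaces each y_b by the sum of
-- x_G over the flats G of M̄ containing b but not 0.  Processing the elements b₁, …, b_d of B
-- in turn, a resulting monomial x_{G₁} ⋯ x_{G_d} vanishes unless G₁ ⊊ ⋯ ⊊ G_d is a chain in
-- which G_i avoids b_{i+1}, …, b_d: otherwise two of its flats, or one of them and a flat from
-- a remaining factor y_{b′}, are incomparable, and x_F x_G = 0 for those.  Along such a chain
-- {b₁, …, b_i} stays independent, so no chain survives unless B (of size d = rk M) is a basis;
-- when it is, the chain is forced to be G_i = cl{b₁, …, b_i}, and its monomial has degree 1.

module Submission where

open import Defs
open import Algebra.Bundles using (CommutativeMonoid)
import Algebra.Properties.CommutativeSemigroup as CommutativeSemigroupProperties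
import Algebra.Properties.Group as GroupProperties
open import Data.Bool using (Bool; true; false; _∧_; _∨_; not; T; if_then_else_)
import Data.Bool.Properties as Boolₚ
open import Data.Empty using (⊥-elim)
open import Data.Fin using (Fin; zero; suc)
import Data.Fin.Properties as Finₚ
open import Data.Fin.Subset using (Subset; _∈_; _∉_; _⊆_; _⊂_; _⊃_; ∣_∣; _∪_; ⁅_⁆; ⊤; ⊥; inside; outside)
import Data.Fin.Subset.Properties as Subsetₚ
import Data.List as List
open import Data.List using (List; []; _∷_; _++_; map; filter; concatMap; length; allFin; reverse; reverseAcc)
import Data.List.Properties as Listₚ
open import Data.List.Membership.Propositional using (lose; find) renaming (_∈_ to _∈ˡ_)
import Data.List.Membership.Propositional.Properties as ∈ˡₚ
open import Data.List.Relation.Unary.All as All using (All; []; _∷_)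
import Data.List.Relation.Unary.All.Properties as Allₚ
open import Data.List.Relation.Unary.Any as Any using (Any; here; there)
import Data.List.Relation.Unary.Any.Properties as Anyₚ
open import Data.List.Relation.Unary.Linked using (Linked; []; [-]; _∷_)
open import Data.List.Relation.Unary.Unique.Propositional using (Unique)
import Data.List.Relation.Unary.AllPairs as AllPairs
import Data.List.Relation.Unary.Unique.Propositional.Properties as Uniqueₚ
open import Data.List.Relation.Binary.Permutation.Propositional using (_↭_; prep; ↭-sym)
import Data.List.Relation.Binary.Permutation.Propositional.Properties as ↭ₚ
import Data.Nat as ℕ
open import Data.Nat using (ℕ; zero; suc; _≤_; _<_; _∸_; _<ᵇ_)
import Data.Nat.Properties as ℕₚ
open import Data.Product using (∃; ∃₂; _×_; _,_; proj₁; proj₂)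
open import Data.Rational using (ℚ; 0ℚ; 1ℚ; _+_)
import Data.Rational.Properties as ℚₚ
open import Data.Sum using (_⊎_; inj₁; inj₂)
open import Data.Vec using ([]; _∷_; here; there; lookup; tabulate)
import Data.Vec.Properties as Vecₚ
open import Function using (_∘_; flip; Equivalence)
open import Relation.Nullary using (¬_; ¬?; Dec; yes; no; does; contradiction)
open import Relation.Nullary.Decidable using (_×-dec_; T?; dec-true; dec-false; decidable-stable)
open import Relation.Unary using (Pred; Decidable)
open import Relation.Binary.PropositionalEquality

open Equivalence using (to; from)

private
  variable
    X Y : Set
    m : ℕ

T-not⇒¬T : ∀ {b} → T (not b) → ¬ T b
T-not⇒¬T {true} ()

¬T⇒T-not : ∀ {b} → ¬ T b → T (not b)
¬T⇒T-not {true} ¬t = ¬t _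
¬T⇒T-not {false} _ = _

∧-∧-not-cong : ∀ x y a b → (T a → ¬ T b → x ≡ y) → (x ∧ a) ∧ not b ≡ y ∧ a ∧ not b
∧-∧-not-cong x y true  true  _    = trans (Boolₚ.∧-zeroʳ _) (sym (Boolₚ.∧-zeroʳ y))
∧-∧-not-cong x y true  false x≡y = begin
  (x ∧ true) ∧ true ≡⟨ Boolₚ.∧-identityʳ _ ⟩
  x ∧ true          ≡⟨ Boolₚ.∧-identityʳ x ⟩
  x                 ≡⟨ x≡y _ (λ ()) ⟩
  y                 ≡⟨ Boolₚ.∧-identityʳ y ⟨
  y ∧ true          ∎
  where open ≡-Reasoning
∧-∧-not-cong x y false b     _    = trans (cong (_∧ not b) (Boolₚ.∧-zeroʳ x)) (sym (Boolₚ.∧-zeroʳ y))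

∈ᵇ⇒∈ : ∀ {x : Fin m} {S} → T (x ∈ᵇ S) → x ∈ S
∈ᵇ⇒∈ {x = x} {S} t = Vecₚ.lookup⇒[]= x S (to Boolₚ.T-≡ t)

∈⇒∈ᵇ : ∀ {x : Fin m} {S} → x ∈ S → T (x ∈ᵇ S)
∈⇒∈ᵇ x∈S = from Boolₚ.T-≡ (Vecₚ.[]=⇒lookup x∈S)

⊆ᵇ⇒⊆ : ∀ {S U : Subset m} → T (S ⊆ᵇ U) → S ⊆ U
⊆ᵇ⇒⊆ {m} t {x} x∈S with to Boolₚ.T-∨ (All.lookup (Allₚ.all⁺ _ (allFin m) t) (∈ˡₚ.∈-allFin x))
... | inj₁ x∉ᵇS = contradiction (∈⇒∈ᵇ x∈S) (T-not⇒¬T x∉ᵇS)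
... | inj₂ x∈ᵇU = ∈ᵇ⇒∈ x∈ᵇU

⊆⇒⊆ᵇ : ∀ {S U : Subset m} → S ⊆ U → T (S ⊆ᵇ U)
⊆⇒⊆ᵇ {m} {S} S⊆U = Allₚ.all⁻ _ (All.tabulate {xs = allFin m} λ {x} _ → member x)
  where
  member : ∀ x → T (not (x ∈ᵇ S) ∨ _)
  member x with x Subsetₚ.∈? S
  ... | yes x∈S = from Boolₚ.T-∨ (inj₂ (∈⇒∈ᵇ (S⊆U x∈S)))
  ... | no x∉S = from Boolₚ.T-∨ (inj₁ (¬T⇒T-not (x∉S ∘ ∈ᵇ⇒∈)))

∈-select⁻ : ∀ (p : X → Bool) {x} xs → x ∈ˡ select p xs → x ∈ˡ xs × T (p x)
∈-select⁻ p xs = ∈ˡₚ.∈-filter⁻ (T? ∘ p) {xs = xs}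

∈-select⁺ : ∀ {p : X → Bool} {x xs} → x ∈ˡ xs → T (p x) → x ∈ˡ select p xs
∈-select⁺ {p = p} = ∈ˡₚ.∈-filter⁺ (T? ∘ p)

Linked-reverse⁺ : ∀ {R : X → X → Set} {xs} → Linked (flip R) xs → Linked R (reverse xs)
Linked-reverse⁺ {R = R} []           = []
Linked-reverse⁺ {R = R} {x ∷ xs} Rxs = onto [-] Rxs
  where
  onto : ∀ {x acc xs} → Linked R (x ∷ acc) → Linked (flip R) (x ∷ xs) → Linked R (reverseAcc (x ∷ acc) xs)
  onto Racc [-]          = Racc
  onto Racc (Ryx ∷ Rxs)  = onto (Ryx ∷ Racc) Rxs

length-select-tabulate : ∀ (S : Subset m) (g : Fin m → X) (p : X → Bool) →
                         (∀ i → p (g i) ≡ lookup S i) → length (select p (List.tabulate g)) ≡ ∣ S ∣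
length-select-tabulate []      g p _ = refl
length-select-tabulate (s ∷ S) g p p∘g≡S with p (g zero) | p∘g≡S zero
... | true  | refl = cong suc (length-select-tabulate S (g ∘ suc) p (p∘g≡S ∘ suc))
... | false | refl = length-select-tabulate S (g ∘ suc) p (p∘g≡S ∘ suc)

length-elements : ∀ (S : Subset m) → length (elements S) ≡ ∣ S ∣
length-elements S = length-select-tabulate S (λ e → e) (_∈ᵇ S) (λ _ → refl)

select-select : ∀ (p q : X → Bool) xs → select q (select p xs) ≡ select (λ x → p x ∧ q x) xs
select-select p q []       = refl
select-select p q (x ∷ xs) with p x
... | false = select-select p q xs
... | true with q x
...   | true  = cong (x ∷_) (select-select p q xs)
...   | false = select-select p q xs

select-cong : ∀ {p q : X → Bool} → (∀ x → p x ≡ q x) → ∀ xs → select p xs ≡ select q xs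
select-cong p≡q []       = refl
select-cong {p = p} {q} p≡q (x ∷ xs) with p x | q x | p≡q x
... | true  | _ | refl = cong (x ∷_) (select-cong p≡q xs)
... | false | _ | refl = select-cong p≡q xs

∈-allSubsets : ∀ m (S : Subset m) → S ∈ˡ allSubsets m
∈-allSubsets zero [] = here refl
∈-allSubsets (suc m) (s ∷ S) =
  ∈ˡₚ.∈-concatMap⁺ _ (Any.map (λ { refl → here-or-there s }) (∈-allSubsets m S))
  where
  here-or-there : ∀ s → (s ∷ S) ∈ˡ (inside ∷ S) ∷ (outside ∷ S) ∷ []
  here-or-there true  = here refl
  here-or-there false = there (here refl)

maxℕ-upper : ∀ {x} xs → x ∈ˡ xs → x ≤ maxℕ xs
maxℕ-upper (y ∷ xs) (here refl) = ℕₚ.m≤m⊔n y (maxℕ xs)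
maxℕ-upper (y ∷ xs) (there x∈) = ℕₚ.≤-trans (maxℕ-upper xs x∈) (ℕₚ.m≤n⊔m y (maxℕ xs))

maxℕ-attained : ∀ xs → maxℕ xs ≡ 0 ⊎ maxℕ xs ∈ˡ xs
maxℕ-attained []       = inj₁ refl
maxℕ-attained (y ∷ xs) with ℕₚ.≤-total y (maxℕ xs) | maxℕ-attained xs
... | inj₂ y≥max | _            = inj₂ (here (ℕₚ.m≥n⇒m⊔n≡m y≥max))
... | inj₁ y≤max | inj₁ max≡0   = inj₁ (trans (ℕₚ.m≤n⇒m⊔n≡n y≤max) max≡0)
... | inj₁ y≤max | inj₂ max∈xs  = inj₂ (subst (_∈ˡ y ∷ xs) (sym (ℕₚ.m≤n⇒m⊔n≡n y≤max)) (there max∈xs))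

∪-⊆ : ∀ {p q r : Subset m} → p ⊆ r → q ⊆ r → p ∪ q ⊆ r
∪-⊆ {p = p} {q} p⊆r q⊆r x∈p∪q with Subsetₚ.x∈p∪q⁻ p q x∈p∪q
... | inj₁ x∈p = p⊆r x∈p
... | inj₂ x∈q = q⊆r x∈q

x∈p∪⁅y⁆⁻ : ∀ (p : Subset m) y {x} → x ∈ p ∪ ⁅ y ⁆ → x ∈ p ⊎ x ≡ y
x∈p∪⁅y⁆⁻ p y x∈ with Subsetₚ.x∈p∪q⁻ p ⁅ y ⁆ x∈
... | inj₁ x∈p = inj₁ x∈p
... | inj₂ x∈y = inj₂ (Subsetₚ.x∈⁅y⁆⇒x≡y y x∈y)

p⊆p∪⁅x⁆ : ∀ {p : Subset m} x → p ⊆ p ∪ ⁅ x ⁆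
p⊆p∪⁅x⁆ x = Subsetₚ.p⊆p∪q ⁅ x ⁆

x∈p∪⁅x⁆ : ∀ (p : Subset m) x → x ∈ p ∪ ⁅ x ⁆
x∈p∪⁅x⁆ p x = Subsetₚ.q⊆p∪q p ⁅ x ⁆ (Subsetₚ.x∈⁅x⁆ x)

∪⁅⁆-⊆ : ∀ {p q : Subset m} {x} → p ⊆ q → x ∈ q → p ∪ ⁅ x ⁆ ⊆ q
∪⁅⁆-⊆ p⊆q x∈q = ∪-⊆ p⊆q (λ y∈x → subst (_∈ _) (sym (Subsetₚ.x∈⁅y⁆⇒x≡y _ y∈x)) x∈q)

∪⁅⁆-swap : ∀ (p : Subset m) x y → (p ∪ ⁅ x ⁆) ∪ ⁅ y ⁆ ⊆ (p ∪ ⁅ y ⁆) ∪ ⁅ x ⁆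
∪⁅⁆-swap p x y = ∪⁅⁆-⊆ (∪⁅⁆-⊆ (p⊆p∪⁅x⁆ x ∘ p⊆p∪⁅x⁆ y) (x∈p∪⁅x⁆ _ x)) (p⊆p∪⁅x⁆ x (x∈p∪⁅x⁆ p y))

∈∉⇒⊈ : ∀ {p q : Subset m} {x} → x ∈ p → x ∉ q → ¬ p ⊆ q
∈∉⇒⊈ x∈p x∉q p⊆q = x∉q (p⊆q x∈p)

∣p∪⁅x⁆∣ : ∀ (p : Subset m) {x} → x ∉ p → ∣ p ∪ ⁅ x ⁆ ∣ ≡ suc ∣ p ∣
∣p∪⁅x⁆∣ (outside ∷ p) {zero}  _   = cong suc (cong ∣_∣ (Subsetₚ.∪-identityʳ p))
∣p∪⁅x⁆∣ (inside  ∷ p) {zero}  x∉p = contradiction here x∉p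
∣p∪⁅x⁆∣ (outside ∷ p) {suc x} x∉p = ∣p∪⁅x⁆∣ p (x∉p ∘ there)
∣p∪⁅x⁆∣ (inside  ∷ p) {suc x} x∉p = cong suc (∣p∪⁅x⁆∣ p (x∉p ∘ there))

open CommutativeSemigroupProperties (CommutativeMonoid.commutativeSemigroup ℚₚ.+-0-commutativeMonoid)
  using (interchange; x∙yz≈y∙xz)

sumℚ-++ : ∀ xs ys → sumℚ (xs ++ ys) ≡ sumℚ xs + sumℚ ys
sumℚ-++ []       ys = sym (ℚₚ.+-identityˡ _)
sumℚ-++ (x ∷ xs) ys = trans (cong (x +_) (sumℚ-++ xs ys)) (sym (ℚₚ.+-assoc x _ _))

sumℚ-map-cong : ∀ {f g : X → ℚ} xs → (∀ {x} → x ∈ˡ xs → f x ≡ g x) →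
                sumℚ (map f xs) ≡ sumℚ (map g xs)
sumℚ-map-cong []       _   = refl
sumℚ-map-cong (x ∷ xs) f≡g = cong₂ _+_ (f≡g (here refl)) (sumℚ-map-cong xs (f≡g ∘ there))

sumℚ-map-zero : ∀ {f : X → ℚ} xs → (∀ {x} → x ∈ˡ xs → f x ≡ 0ℚ) → sumℚ (map f xs) ≡ 0ℚ
sumℚ-map-zero []       _    = refl
sumℚ-map-zero (x ∷ xs) f≡0 =
  trans (cong₂ _+_ (f≡0 (here refl)) (sumℚ-map-zero xs (f≡0 ∘ there))) (ℚₚ.+-identityˡ 0ℚ)

sumℚ-map-+ : ∀ (f g : X → ℚ) xs →
             sumℚ (map (λ x → f x + g x) xs) ≡ sumℚ (map f xs) + sumℚ (map g xs)
sumℚ-map-+ f g []       = sym (ℚₚ.+-identityˡ 0ℚ)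
sumℚ-map-+ f g (x ∷ xs) =
  trans (cong (f x + g x +_) (sumℚ-map-+ f g xs)) (interchange (f x) (g x) _ _)

sumℚ-map-comm : ∀ (f : X → Y → ℚ) xs ys →
                sumℚ (map (λ x → sumℚ (map (f x) ys)) xs) ≡
                sumℚ (map (λ y → sumℚ (map (λ x → f x y) xs)) ys)
sumℚ-map-comm f []       ys = sym (sumℚ-map-zero ys (λ _ → refl))
sumℚ-map-comm f (x ∷ xs) ys =
  trans (cong (sumℚ (map (f x) ys) +_) (sumℚ-map-comm f xs ys))
        (sym (sumℚ-map-+ (f x) (λ y → sumℚ (map (λ x → f x y) xs)) ys))

sumℚ-concatMap : ∀ (f : Y → ℚ) (g : X → List Y) xs →
                 sumℚ (map f (concatMap g xs)) ≡ sumℚ (map (λ x → sumℚ (map f (g x))) xs)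
sumℚ-concatMap f g []       = refl
sumℚ-concatMap f g (x ∷ xs) = begin
  sumℚ (map f (g x ++ concatMap g xs))
    ≡⟨ cong sumℚ (Listₚ.map-++ f (g x) _) ⟩
  sumℚ (map f (g x) ++ map f (concatMap g xs))
    ≡⟨ sumℚ-++ (map f (g x)) _ ⟩
  sumℚ (map f (g x)) + sumℚ (map f (concatMap g xs))
    ≡⟨ cong (sumℚ (map f (g x)) +_) (sumℚ-concatMap f g xs) ⟩
  sumℚ (map (λ x → sumℚ (map f (g x))) (x ∷ xs)) ∎
  where open ≡-Reasoning

module _ {p} {P : Pred X p} (P? : Decidable P) where

  sumℚ-filter : ∀ (f : X → ℚ) xs →
                sumℚ (map f (filter P? xs)) ≡ sumℚ (map (λ x → if does (P? x) then f x else 0ℚ) xs)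
  sumℚ-filter f []       = refl
  sumℚ-filter f (x ∷ xs) with does (P? x)
  ... | true  = cong (f x +_) (sumℚ-filter f xs)
  ... | false = trans (sumℚ-filter f xs) (sym (ℚₚ.+-identityˡ _))

  sumℚ-filter-vanishing : ∀ (f : X → ℚ) xs → (∀ {x} → x ∈ˡ xs → ¬ P x → f x ≡ 0ℚ) →
                          sumℚ (map f xs) ≡ sumℚ (map f (filter P? xs))
  sumℚ-filter-vanishing f []       _   = refl
  sumℚ-filter-vanishing f (x ∷ xs) f≡0 with ih ← sumℚ-filter-vanishing f xs (f≡0 ∘ there) | P? x
  ... | yes _  = cong (f x +_) ih
  ... | no ¬Px = trans (cong₂ _+_ (f≡0 (here refl) ¬Px) ih) (ℚₚ.+-identityˡ _)

sumℚ-select-split : ∀ (p q : X → Bool) (f : X → ℚ) xs →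
                    sumℚ (map f (select p xs)) ≡
                    sumℚ (map f (select (λ x → p x ∧ q x) xs)) +
                    sumℚ (map f (select (λ x → p x ∧ not (q x)) xs))
sumℚ-select-split p q f []       = sym (ℚₚ.+-identityˡ 0ℚ)
sumℚ-select-split p q f (x ∷ xs) with ih ← sumℚ-select-split p q f xs | p x
... | false = ih
... | true with q x
...   | true  = trans (cong (f x +_) ih) (sym (ℚₚ.+-assoc (f x) _ _))
...   | false = trans (cong (f x +_) ih)
                      (x∙yz≈y∙xz (f x) (sumℚ (map f (select (λ x → p x ∧ q x) xs)))
                                       (sumℚ (map f (select (λ x → p x ∧ not (q x)) xs))))

sumℚ-fibre : ∀ (g : Subset (suc m) → ℚ) s S → (∀ U → U ≢ s ∷ S → g U ≡ 0ℚ) →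
             ∀ U → g (inside ∷ U) + (g (outside ∷ U) + 0ℚ) ≡ g (s ∷ U)
sumℚ-fibre g true S g≡0 U = begin
  g (inside ∷ U) + (g (outside ∷ U) + 0ℚ) ≡⟨ cong (λ q → g (inside ∷ U) + (q + 0ℚ)) (g≡0 _ λ ()) ⟩
  g (inside ∷ U) + (0ℚ + 0ℚ)              ≡⟨ ℚₚ.+-identityʳ _ ⟩
  g (inside ∷ U)                          ∎
  where open ≡-Reasoning
sumℚ-fibre g false S g≡0 U = begin
  g (inside ∷ U) + (g (outside ∷ U) + 0ℚ) ≡⟨ cong (_+ (g (outside ∷ U) + 0ℚ)) (g≡0 _ λ ()) ⟩
  0ℚ + (g (outside ∷ U) + 0ℚ)             ≡⟨ ℚₚ.+-identityˡ _ ⟩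
  g (outside ∷ U) + 0ℚ                    ≡⟨ ℚₚ.+-identityʳ _ ⟩
  g (outside ∷ U)                         ∎
  where open ≡-Reasoning

sumℚ-allSubsets-supported : ∀ m (g : Subset m → ℚ) S → (∀ U → U ≢ S → g U ≡ 0ℚ) →
                            sumℚ (map g (allSubsets m)) ≡ g S
sumℚ-allSubsets-supported zero    g [] _       = ℚₚ.+-identityʳ (g [])
sumℚ-allSubsets-supported (suc m) g (s ∷ S) g≡0 = begin
  sumℚ (map g (allSubsets (suc m)))
    ≡⟨ sumℚ-concatMap g _ (allSubsets m) ⟩
  sumℚ (map (λ U → g (inside ∷ U) + (g (outside ∷ U) + 0ℚ)) (allSubsets m))
    ≡⟨ sumℚ-map-cong (allSubsets m) (λ {U} _ → sumℚ-fibre g s S g≡0 U) ⟩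
  sumℚ (map (λ U → g (s ∷ U)) (allSubsets m))
    ≡⟨ sumℚ-allSubsets-supported m (λ U → g (s ∷ U)) S (λ U U≢S → g≡0 (s ∷ U) (U≢S ∘ Vecₚ.∷-injectiveʳ)) ⟩
  g (s ∷ S) ∎
  where open ≡-Reasoning

sumℚ-filter-select-supported :
  ∀ (p : Subset m → Bool) {q} {Q : Pred (Subset m) q} (Q? : Decidable Q) (f : Subset m → ℚ) S → T (p S) →
  (∀ {U} → U ∈ˡ filter Q? (select p (allSubsets m)) → U ≢ S → f U ≡ 0ℚ) →
  sumℚ (map f (filter Q? (select p (allSubsets m)))) ≡ (if does (Q? S) then f S else 0ℚ)
sumℚ-filter-select-supported {m} p Q? f S pS f≡0 = begin
  sumℚ (map f (filter Q? (select p (allSubsets m))))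
    ≡⟨ sumℚ-filter Q? f (select p (allSubsets m)) ⟩
  sumℚ (map (λ U → if does (Q? U) then f U else 0ℚ) (select p (allSubsets m)))
    ≡⟨ sumℚ-filter (T? ∘ p) _ (allSubsets m) ⟩
  sumℚ (map g (allSubsets m))
    ≡⟨ sumℚ-allSubsets-supported m g S support ⟩
  g S
    ≡⟨ at-S (p S) pS ⟩
  (if does (Q? S) then f S else 0ℚ) ∎
  where
  open ≡-Reasoning
  g : Subset m → ℚ
  g U = if p U then (if does (Q? U) then f U else 0ℚ) else 0ℚ
  support : ∀ U → U ≢ S → g U ≡ 0ℚ
  support U U≢S with p U in pU≡true | Q? U
  ... | false | _     = refl
  ... | true  | no _  = refl
  ... | true  | yes QU =
    f≡0 (∈ˡₚ.∈-filter⁺ Q? (∈-select⁺ (∈-allSubsets m U) (from Boolₚ.T-≡ pU≡true)) QU) U≢S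
  at-S : ∀ b → T b →
         (if b then (if does (Q? S) then f S else 0ℚ) else 0ℚ) ≡ (if does (Q? S) then f S else 0ℚ)
  at-S true _ = refl

indicator : ∀ {X : Set} → Dec X → ℚ
indicator X? = if does X? then 1ℚ else 0ℚ

indicator-yes : ∀ {X : Set} (X? : Dec X) → X → indicator X? ≡ 1ℚ
indicator-yes X? x = cong (if_then 1ℚ else 0ℚ) (dec-true X? x)

indicator-no : ∀ {X : Set} (X? : Dec X) → ¬ X → indicator X? ≡ 0ℚ
indicator-no X? ¬x = cong (if_then 1ℚ else 0ℚ) (dec-false X? ¬x)

-- Rank, flats and closure in a matroid

module MatroidProperties (N : Matroid m) where

  rank : Subset m → ℕ
  rank = rankOf (indep N)

  Flat : Subset m → Set
  Flat G = T (isFlat (indep N) G)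

  Indep : Subset m → Set
  Indep I = T (indep N I)

  indep⇒≤rank : ∀ {I S} → Indep I → I ⊆ S → ∣ I ∣ ≤ rank S
  indep⇒≤rank {I} {S} iI I⊆S = maxℕ-upper _ (∈ˡₚ.∈-map⁺ ∣_∣
    (∈-select⁺ (∈-allSubsets m I) (from Boolₚ.T-∧ (⊆⇒⊆ᵇ I⊆S , iI))))

  rank-attained : ∀ S → ∃ λ J → Indep J × J ⊆ S × ∣ J ∣ ≡ rank S
  rank-attained S with maxℕ-attained (map ∣_∣ (select (λ I → (I ⊆ᵇ S) ∧ indep N I) (allSubsets m)))
  ... | inj₁ rank≡0 = ⊥ , indep-∅ N , Subsetₚ.⊥⊆ , trans (Subsetₚ.∣⊥∣≡0 m) (sym rank≡0)
  ... | inj₂ rank∈ =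
    let J , J∈ , rank≡∣J∣ = ∈ˡₚ.∈-map⁻ ∣_∣ rank∈
        J⊆ᵇS , iJ = to Boolₚ.T-∧ (proj₂ (∈-select⁻ (λ I → (I ⊆ᵇ S) ∧ indep N I) (allSubsets m) J∈))
    in J , iJ , ⊆ᵇ⇒⊆ J⊆ᵇS , sym rank≡∣J∣

  indep-grow : ∀ {I K} → Indep I → Indep K → ∣ I ∣ ≤ ∣ K ∣ →
               ∃ λ J → I ⊆ J × J ⊆ I ∪ K × Indep J × ∣ J ∣ ≡ ∣ K ∣
  indep-grow {I} {K} iI iK ∣I∣≤∣K∣ = grow (∣ K ∣ ∸ ∣ I ∣) iI (ℕₚ.m∸n+n≡m ∣I∣≤∣K∣)
    where
    grow : ∀ k {I} → Indep I → k ℕ.+ ∣ I ∣ ≡ ∣ K ∣ →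
           ∃ λ J → I ⊆ J × J ⊆ I ∪ K × Indep J × ∣ J ∣ ≡ ∣ K ∣
    grow zero    {I} iI ∣I∣≡∣K∣ = I , (λ x∈ → x∈) , Subsetₚ.p⊆p∪q K , iI , ∣I∣≡∣K∣
    grow (suc k) {I} iI k+∣I∣≡∣K∣
      with x , x∈K , x∉I , iIx ← indep-aug N I K iI iK
                                   (subst (∣ I ∣ <_) k+∣I∣≡∣K∣ (ℕₚ.m<n+m ∣ I ∣ (ℕ.s≤s ℕ.z≤n)))
      with J , Ix⊆J , J⊆Ix∪K , iJ , ∣J∣≡∣K∣ ← grow k iIx (trans (cong (k ℕ.+_) (∣p∪⁅x⁆∣ I x∉I))
                                                               (trans (ℕₚ.+-suc k _) k+∣I∣≡∣K∣))
      = J , Ix⊆J ∘ p⊆p∪⁅x⁆ x , J⊆I∪K , iJ , ∣J∣≡∣K∣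
      where
      J⊆I∪K : J ⊆ I ∪ K
      J⊆I∪K = Subsetₚ.⊆-trans J⊆Ix∪K
                (∪-⊆ (∪⁅⁆-⊆ (Subsetₚ.p⊆p∪q K) (Subsetₚ.q⊆p∪q I K x∈K)) (Subsetₚ.q⊆p∪q I K))

  flat⇒rank< : ∀ {G e} → Flat G → e ∉ G → rank G < rank (G ∪ ⁅ e ⁆)
  flat⇒rank< {G} {e} G-flat e∉G
    with to Boolₚ.T-∨ (All.lookup (Allₚ.all⁺ _ (allFin m) G-flat) (∈ˡₚ.∈-allFin e))
  ... | inj₁ e∈ᵇG = contradiction (∈ᵇ⇒∈ e∈ᵇG) e∉G
  ... | inj₂ rank<ᵇ = ℕₚ.<ᵇ⇒< _ _ rank<ᵇ

  rank<⇒flat : ∀ {G} → (∀ {e} → e ∉ G → rank G < rank (G ∪ ⁅ e ⁆)) → Flat G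
  rank<⇒flat {G} rank< = Allₚ.all⁻ _ (All.tabulate {xs = allFin m} λ {e} _ → grows e)
    where
    grows : ∀ e → T ((e ∈ᵇ G) ∨ (rank G <ᵇ rank (G ∪ ⁅ e ⁆)))
    grows e with e Subsetₚ.∈? G
    ... | yes e∈G = from Boolₚ.T-∨ (inj₁ (∈⇒∈ᵇ e∈G))
    ... | no e∉G  = from Boolₚ.T-∨ (inj₂ (ℕₚ.<⇒<ᵇ (rank< e∉G)))

  -- Grow I inside a largest independent subset of G ∪ e: the result is too large to lie in G.
  flat-indep-∪ : ∀ {G I e} → Flat G → Indep I → I ⊆ G → e ∉ G → Indep (I ∪ ⁅ e ⁆)
  flat-indep-∪ {G} {I} {e} G-flat iI I⊆G e∉G = through (rank-attained (G ∪ ⁅ e ⁆))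
    where
    rank<rank∪e : rank G < rank (G ∪ ⁅ e ⁆)
    rank<rank∪e = flat⇒rank< G-flat e∉G
    through : (∃ λ K → Indep K × K ⊆ G ∪ ⁅ e ⁆ × ∣ K ∣ ≡ rank (G ∪ ⁅ e ⁆)) → Indep (I ∪ ⁅ e ⁆)
    through (K , iK , K⊆G∪e , ∣K∣≡rank)
      with rank<∣K∣ ← subst (rank G <_) (sym ∣K∣≡rank) rank<rank∪e
      with J , I⊆J , J⊆I∪K , iJ , ∣J∣≡∣K∣ ←
             indep-grow iI iK (ℕₚ.≤-trans (indep⇒≤rank iI I⊆G) (ℕₚ.<⇒≤ rank<∣K∣))
      with e Subsetₚ.∈? J
    ... | yes e∈J = indep-⊆ N J (I ∪ ⁅ e ⁆) (∪⁅⁆-⊆ I⊆J e∈J) iJ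
    ... | no e∉J  = ⊥-elim (ℕₚ.<⇒≱ (subst (rank G <_) (sym ∣J∣≡∣K∣) rank<∣K∣) (indep⇒≤rank iJ J⊆G))
      where
      J⊆G : J ⊆ G
      J⊆G y∈J with Subsetₚ.x∈p∪q⁻ I K (J⊆I∪K y∈J)
      ... | inj₁ y∈I = I⊆G y∈I
      ... | inj₂ y∈K with x∈p∪⁅y⁆⁻ G e (K⊆G∪e y∈K)
      ...   | inj₁ y∈G  = y∈G
      ...   | inj₂ refl = contradiction y∈J e∉J

  -- For independent S this is the closure of S; for dependent S it is ⊤.
  cl : Subset m → Subset m
  cl S = tabulate (λ x → (x ∈ᵇ S) ∨ not (indep N (S ∪ ⁅ x ⁆)))

  ∈-cl⁻ : ∀ {S x} → x ∈ cl S → x ∈ S ⊎ ¬ Indep (S ∪ ⁅ x ⁆)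
  ∈-cl⁻ {S} {x} x∈cl with to Boolₚ.T-∨ (subst T (Vecₚ.lookup∘tabulate _ x) (∈⇒∈ᵇ x∈cl))
  ... | inj₁ x∈ᵇS = inj₁ (∈ᵇ⇒∈ x∈ᵇS)
  ... | inj₂ dep  = inj₂ (T-not⇒¬T dep)

  ∈-cl⁺ : ∀ {S x} → x ∈ S ⊎ ¬ Indep (S ∪ ⁅ x ⁆) → x ∈ cl S
  ∈-cl⁺ {S} {x} h = ∈ᵇ⇒∈ (subst T (sym (Vecₚ.lookup∘tabulate _ x)) (from Boolₚ.T-∨ (reflect h)))
    where
    reflect : x ∈ S ⊎ ¬ Indep (S ∪ ⁅ x ⁆) → T (x ∈ᵇ S) ⊎ T (not (indep N (S ∪ ⁅ x ⁆)))
    reflect (inj₁ x∈S) = inj₁ (∈⇒∈ᵇ x∈S)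
    reflect (inj₂ dep) = inj₂ (¬T⇒T-not dep)

  ⊆-cl : ∀ {S} → S ⊆ cl S
  ⊆-cl x∈S = ∈-cl⁺ (inj₁ x∈S)

  ∉-cl⁻ : ∀ {S x} → x ∉ cl S → Indep (S ∪ ⁅ x ⁆) × x ∉ S
  ∉-cl⁻ {S} {x} x∉cl with T? (indep N (S ∪ ⁅ x ⁆))
  ... | yes iSx = iSx , x∉cl ∘ ⊆-cl
  ... | no dep  = contradiction (∈-cl⁺ (inj₂ dep)) x∉cl

  rank-cl≤ : ∀ {S} → Indep S → rank (cl S) ≤ ∣ S ∣
  rank-cl≤ {S} iS with J , iJ , J⊆cl , ∣J∣≡rank ← rank-attained (cl S)
                  with ℕₚ.≤-<-connex (rank (cl S)) ∣ S ∣
  ... | inj₁ rank≤ = rank≤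
  ... | inj₂ ∣S∣<rank
    with x , x∈J , x∉S , iSx ← indep-aug N S J iS iJ (subst (∣ S ∣ <_) (sym ∣J∣≡rank) ∣S∣<rank)
    with ∈-cl⁻ (J⊆cl x∈J)
  ... | inj₁ x∈S = contradiction x∈S x∉S
  ... | inj₂ dep = contradiction iSx dep

  cl-flat : ∀ {S} → Indep S → Flat (cl S)
  cl-flat {S} iS = rank<⇒flat grows
    where
    grows : ∀ {e} → e ∉ cl S → rank (cl S) < rank (cl S ∪ ⁅ e ⁆)
    grows {e} e∉cl with iSe , e∉S ← ∉-cl⁻ e∉cl = ℕₚ.≤-trans (ℕ.s≤s (rank-cl≤ iS))
      (subst (_≤ rank (cl S ∪ ⁅ e ⁆)) (∣p∪⁅x⁆∣ S e∉S)
        (indep⇒≤rank iSe (∪⁅⁆-⊆ (p⊆p∪⁅x⁆ e ∘ ⊆-cl) (x∈p∪⁅x⁆ (cl S) e))))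

  cl-least : ∀ {G S} → Flat G → Indep S → S ⊆ G → cl S ⊆ G
  cl-least {G} {S} G-flat iS S⊆G {x} x∈cl with x Subsetₚ.∈? G | ∈-cl⁻ x∈cl
  ... | yes x∈G | _          = x∈G
  ... | no _    | inj₁ x∈S   = S⊆G x∈S
  ... | no x∉G  | inj₂ dep   = contradiction (flat-indep-∪ G-flat iS S⊆G x∉G) dep

  cl-⊥ : Loopless N → cl ⊥ ≡ ⊥
  cl-⊥ loopless = Subsetₚ.⊆-antisym cl⊥⊆⊥ Subsetₚ.⊥⊆
    where
    cl⊥⊆⊥ : cl ⊥ ⊆ ⊥
    cl⊥⊆⊥ {x} x∈cl with ∈-cl⁻ x∈cl
    ... | inj₁ x∈⊥ = x∈⊥
    ... | inj₂ dep =
      contradiction (indep-⊆ N ⁅ x ⁆ (⊥ ∪ ⁅ x ⁆) (∪⁅⁆-⊆ Subsetₚ.⊥⊆ (Subsetₚ.x∈⁅x⁆ x)) (loopless x)) dep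

  ⊥-flat : Loopless N → Flat ⊥
  ⊥-flat loopless = subst Flat (cl-⊥ loopless) (cl-flat (indep-∅ N))

  indep-of-full-rank⇒basis : ∀ {B} → Indep B → ∣ B ∣ ≡ rank ⊤ → IsBasis N B
  indep-of-full-rank⇒basis {B} iB ∣B∣≡rank = iB , maximal
    where
    maximal : ∀ e → e ∉ B → ¬ Indep (B ∪ ⁅ e ⁆)
    maximal e e∉B iBe = ℕₚ.<-irrefl ∣B∣≡rank
      (subst (_≤ rank ⊤) (∣p∪⁅x⁆∣ B e∉B) (indep⇒≤rank iBe Subsetₚ.⊆⊤))

-- Adding a coloop

indepBar-∪-zero : ∀ (ind : Subset m → Bool) {S} → T (indepBar ind S) → T (indepBar ind (S ∪ ⁅ zero ⁆))
indepBar-∪-zero ind {_ ∷ S} = subst (T ∘ ind) (sym (Subsetₚ.∪-identityʳ S))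

addColoop : Matroid m → Matroid (suc m)
addColoop M = record
  { indep     = indepBar (indep M)
  ; indep-∅   = indep-∅ M
  ; indep-⊆   = ⊆-closed
  ; indep-aug = augment
  }
  where
  ⊆-closed : ∀ I J → J ⊆ I → T (indepBar (indep M) I) → T (indepBar (indep M) J)
  ⊆-closed (_ ∷ I) (_ ∷ J) J⊆I = indep-⊆ M I J (Subsetₚ.drop-∷-⊆ J⊆I)

  augment : ∀ I J → T (indepBar (indep M) I) → T (indepBar (indep M) J) → ∣ I ∣ < ∣ J ∣ →
            ∃ λ e → e ∈ J × e ∉ I × T (indepBar (indep M) (I ∪ ⁅ e ⁆))
  augment (i ∷ I) (j ∷ J) iI iJ = cases i j
    where
    Augments : Bool → Bool → Set
    Augments i j = ∃ λ e → e ∈ j ∷ J × e ∉ i ∷ I × T (indepBar (indep M) ((i ∷ I) ∪ ⁅ e ⁆))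
    fromM : ∀ {i j} → ∣ I ∣ < ∣ J ∣ → Augments i j
    fromM ∣I∣<∣J∣ with e , e∈J , e∉I , iIe ← indep-aug M I J iI iJ ∣I∣<∣J∣ =
      suc e , there e∈J , e∉I ∘ Subsetₚ.drop-there , iIe
    cases : ∀ i j → ∣ i ∷ I ∣ < ∣ j ∷ J ∣ → Augments i j
    cases outside inside  _ = zero , here , (λ ()) , indepBar-∪-zero (indep M) {outside ∷ I} iI
    cases outside outside ∣I∣<∣J∣ = fromM ∣I∣<∣J∣
    cases inside  inside  ∣I∣<∣J∣ = fromM (ℕₚ.≤-pred ∣I∣<∣J∣)
    cases inside  outside ∣I∣<∣J∣ = fromM (ℕₚ.<-trans (ℕₚ.n<1+n _) ∣I∣<∣J∣)

addColoop-loopless : ∀ {M : Matroid m} → Loopless M → Loopless (addColoop M)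
addColoop-loopless {M = M} loopless zero    = indep-∅ M
addColoop-loopless         loopless (suc e) = loopless e

-- The relations of A(M̄) used in the expansion of ∏ y_e

module Expansion {n : ℕ} (M : Matroid n) (d : ℕ) (φ : List (Subset (suc n)) → ℚ)
                 (isDeg : ChowRing.IsDeg M d φ) where

  open ChowRing M
  open ChowRing.IsDeg isDeg
  open MatroidProperties (addColoop M) using (Flat)
  open GroupProperties ℚₚ.+-0-group using (∙-cancelˡ)

  separating : Fin (suc n) → Fin (suc n) → Subset (suc n) → Bool
  separating e₁ e₂ F = isFlat Ē-indep F ∧ (e₁ ∈ᵇ F) ∧ not (e₂ ∈ᵇ F)

  separatingFlats : Fin (suc n) → Fin (suc n) → List (Subset (suc n))
  separatingFlats e₁ e₂ = select (separating e₁ e₂) (allSubsets (suc n))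

  separating⁻ : ∀ {e₁ e₂ F} → T (separating e₁ e₂ F) → Flat F × e₁ ∈ F × e₂ ∉ F
  separating⁻ t =
    let flat , e₁∈F∧e₂∉F = to Boolₚ.T-∧ t
        e₁∈F , e₂∉F = to Boolₚ.T-∧ e₁∈F∧e₂∉F
    in flat , ∈ᵇ⇒∈ e₁∈F , T-not⇒¬T e₂∉F ∘ ∈⇒∈ᵇ

  separating⁺ : ∀ {e₁ e₂ F} → Flat F → e₁ ∈ F → e₂ ∉ F → T (separating e₁ e₂ F)
  separating⁺ flat e₁∈F e₂∉F =
    from Boolₚ.T-∧ (flat , from Boolₚ.T-∧ (∈⇒∈ᵇ e₁∈F , ¬T⇒T-not (e₂∉F ∘ ∈ᵇ⇒∈)))

  ∈-separatingFlats⁻ : ∀ {e₁ e₂ F} → F ∈ˡ separatingFlats e₁ e₂ → Flat F × e₁ ∈ F × e₂ ∉ F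
  ∈-separatingFlats⁻ F∈ = separating⁻ (proj₂ (∈-select⁻ _ (allSubsets (suc n)) F∈))

  isNPFlat-separating : ∀ {e₁ e₂} F → e₁ ∈ F → e₂ ∉ F → isNPFlat F ≡ isFlat Ē-indep F
  isNPFlat-separating {e₁} {e₂} F e₁∈F e₂∉F
    rewrite to Boolₚ.T-≡ (Anyₚ.any⁺ (_∈ᵇ F) (lose (∈ˡₚ.∈-allFin e₁) (∈⇒∈ᵇ e₁∈F)))
          | to Boolₚ.T-not-≡ (¬T⇒T-not λ all∈F →
              e₂∉F (∈ᵇ⇒∈ (All.lookup (Allₚ.all⁺ (_∈ᵇ F) _ all∈F) (∈ˡₚ.∈-allFin e₂))))
    = Boolₚ.∧-identityʳ _

  separatingFlats-NP : ∀ {e₁ e₂} → All (T ∘ isNPFlat) (separatingFlats e₁ e₂)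
  separatingFlats-NP {e₁} {e₂} = All.tabulate λ F∈ →
    let flat , e₁∈F , e₂∉F = ∈-separatingFlats⁻ F∈
    in subst T (sym (isNPFlat-separating _ e₁∈F e₂∉F)) flat

  sum-containing-split : ∀ (f : Subset (suc n) → ℚ) e₁ e₂ →
    sumℚ (map f (select (e₁ ∈ᵇ_) NPFlats)) ≡
    sumℚ (map f (select (λ F → (isNPFlat F ∧ e₁ ∈ᵇ F) ∧ e₂ ∈ᵇ F) (allSubsets (suc n)))) +
    sumℚ (map f (separatingFlats e₁ e₂))
  sum-containing-split f e₁ e₂ = begin
    sumℚ (map f (select (e₁ ∈ᵇ_) NPFlats))
      ≡⟨ cong (sumℚ ∘ map f) (select-select isNPFlat (e₁ ∈ᵇ_) subsets) ⟩
    sumℚ (map f (select containing subsets))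
      ≡⟨ sumℚ-select-split containing (e₂ ∈ᵇ_) f subsets ⟩
    Σboth + sumℚ (map f (select (λ F → containing F ∧ not (e₂ ∈ᵇ F)) subsets))
      ≡⟨ cong (Σboth +_) (cong (sumℚ ∘ map f) (select-cong separates subsets)) ⟩
    Σboth + sumℚ (map f (separatingFlats e₁ e₂)) ∎
    where
    open ≡-Reasoning
    subsets : List (Subset (suc n))
    subsets = allSubsets (suc n)
    containing : Subset (suc n) → Bool
    containing F = isNPFlat F ∧ e₁ ∈ᵇ F
    Σboth : ℚ
    Σboth = sumℚ (map f (select (λ F → containing F ∧ e₂ ∈ᵇ F) subsets))
    separates : ∀ F → containing F ∧ not (e₂ ∈ᵇ F) ≡ separating e₁ e₂ F
    separates F = ∧-∧-not-cong (isNPFlat F) (isFlat Ē-indep F) (e₁ ∈ᵇ F) (e₂ ∈ᵇ F)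
      λ e₁∈F e₂∉F → isNPFlat-separating F (∈ᵇ⇒∈ e₁∈F) (e₂∉F ∘ ∈⇒∈ᵇ)

  -- The linear relation for e₁, e₂ minus the terms from flats containing both.
  linear-separating : ∀ rest → AllNP rest → suc (length rest) ≡ d → ∀ {e₁ e₂} → e₁ ≢ e₂ →
    sumℚ (map (λ F → φ (F ∷ rest)) (separatingFlats e₁ e₂)) ≡
    sumℚ (map (λ F → φ (F ∷ rest)) (separatingFlats e₂ e₁))
  linear-separating rest np len {e₁} {e₂} e₁≢e₂ =
    ∙-cancelˡ (both e₁ e₂) (Σseparating e₁ e₂) (Σseparating e₂ e₁) (begin
    both e₁ e₂ + Σseparating e₁ e₂         ≡⟨ sum-containing-split f e₁ e₂ ⟨
    sumℚ (map f (select (e₁ ∈ᵇ_) NPFlats)) ≡⟨ linear rest np len e₁ e₂ e₁≢e₂ ⟩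
    sumℚ (map f (select (e₂ ∈ᵇ_) NPFlats)) ≡⟨ sum-containing-split f e₂ e₁ ⟩
    both e₂ e₁ + Σseparating e₂ e₁         ≡⟨ cong (_+ Σseparating e₂ e₁) both-comm ⟩
    both e₁ e₂ + Σseparating e₂ e₁         ∎)
    where
    open ≡-Reasoning
    f : Subset (suc n) → ℚ
    f F = φ (F ∷ rest)
    Σseparating : Fin (suc n) → Fin (suc n) → ℚ
    Σseparating a b = sumℚ (map f (separatingFlats a b))
    both : Fin (suc n) → Fin (suc n) → ℚ
    both a b = sumℚ (map f (select (λ F → (isNPFlat F ∧ a ∈ᵇ F) ∧ b ∈ᵇ F) (allSubsets (suc n))))
    both-comm : both e₂ e₁ ≡ both e₁ e₂
    both-comm = cong (sumℚ ∘ map f) (select-cong (λ F →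
      trans (Boolₚ.∧-assoc (isNPFlat F) (e₂ ∈ᵇ F) (e₁ ∈ᵇ F))
        (trans (cong (isNPFlat F ∧_) (Boolₚ.∧-comm (e₂ ∈ᵇ F) (e₁ ∈ᵇ F)))
               (sym (Boolₚ.∧-assoc (isNPFlat F) (e₁ ∈ᵇ F) (e₂ ∈ᵇ F)))))
      (allSubsets (suc n)))

  ∈-choices⁻ : ∀ {r : List X} xs xss → r ∈ˡ choices (xs ∷ xss) →
               ∃₂ λ x r′ → x ∈ˡ xs × r′ ∈ˡ choices xss × r ≡ x ∷ r′
  ∈-choices⁻ xs xss r∈ =
    let x , x∈xs , r∈x∷ = find (∈ˡₚ.∈-concatMap⁻ (λ x → map (x ∷_) (choices xss)) {xs = xs} r∈)
        r′ , r′∈ , r≡x∷r′ = ∈ˡₚ.∈-map⁻ (x ∷_) r∈x∷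
    in x , r′ , x∈xs , r′∈ , r≡x∷r′

  choices-length : ∀ {r : List X} xss → r ∈ˡ choices xss → length r ≡ length xss
  choices-length []         (here refl) = refl
  choices-length (xs ∷ xss) r∈ with _ , r′ , _ , r′∈ , refl ← ∈-choices⁻ xs xss r∈ =
    cong suc (choices-length xss r′∈)

  choices-All : ∀ {p} {P : Pred X p} {r} xss → All (All P) xss → r ∈ˡ choices xss → All P r
  choices-All []         []           (here refl) = []
  choices-All (xs ∷ xss) (Pxs ∷ Pxss) r∈ with x , r′ , x∈xs , r′∈ , refl ← ∈-choices⁻ xs xss r∈ =
    All.lookup Pxs x∈xs ∷ choices-All xss Pxss r′∈

  choices-meets : ∀ {r : List X} {xs} xss → xs ∈ˡ xss → r ∈ˡ choices xss → ∃ λ x → x ∈ˡ r × x ∈ˡ xs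
  choices-meets (ys ∷ xss) xs∈ r∈ with x , r′ , x∈ys , r′∈ , refl ← ∈-choices⁻ ys xss r∈ with xs∈
  ... | here refl = x , here refl , x∈ys
  ... | there xs∈xss = let y , y∈r′ , y∈xs = choices-meets xss xs∈xss r′∈ in y , there y∈r′ , y∈xs

  φ-incomparable : ∀ {G H} mono → H ∈ˡ mono → AllNP (G ∷ mono) → length (G ∷ mono) ≡ d →
                   ¬ G ⊆ H → ¬ H ⊆ G → φ (G ∷ mono) ≡ 0ℚ
  φ-incomparable {G} {H} mono H∈ np len G⊈H H⊈G with ys , zs , refl ← ∈ˡₚ.∈-∃++ H∈ =
    trans (symm _ _ G∷mono↭) (incomp G H (ys ++ zs) (↭ₚ.All-resp-↭ G∷mono↭ np)
                                 (trans (sym (↭ₚ.↭-length G∷mono↭)) len) G⊈H H⊈G)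
    where
    G∷mono↭ : G ∷ ys ++ H ∷ zs ↭ G ∷ H ∷ ys ++ zs
    G∷mono↭ = prep G (↭ₚ.shift H ys zs)

  -- φ (x_P ⋅ ∏_{e ∈ es} y_e), with the product expanded by multilinearity
  degXProdY : Monomial → List (Fin n) → ℚ
  degXProdY P es = sumℚ (map (λ r → φ (P ++ r)) (choices (map yFlats es)))

  choice-NP : ∀ {r} es → r ∈ˡ choices (map yFlats es) → AllNP r
  choice-NP es = choices-All (map yFlats es) (Allₚ.map⁺ (All.tabulate {xs = es} λ _ → separatingFlats-NP))

  suc-length-++-choice : ∀ P {b r} es → length P ℕ.+ length (b ∷ es) ≡ d →
                         r ∈ˡ choices (map yFlats es) → suc (length (P ++ r)) ≡ d
  suc-length-++-choice P {r = r} es len r∈ = begin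
    suc (length (P ++ r))         ≡⟨ cong suc (Listₚ.length-++ P) ⟩
    suc (length P ℕ.+ length r)   ≡⟨ cong (λ k → suc (length P ℕ.+ k)) length-r ⟩
    suc (length P ℕ.+ length es)  ≡⟨ ℕₚ.+-suc (length P) (length es) ⟨
    length P ℕ.+ suc (length es)  ≡⟨ len ⟩
    d                             ∎
    where
    open ≡-Reasoning
    length-r : length r ≡ length es
    length-r = trans (choices-length (map yFlats es) r∈) (Listₚ.length-map yFlats es)

  φ-++-∷ : ∀ P F r → φ (P ++ F ∷ r) ≡ φ (F ∷ P ++ r)
  φ-++-∷ P F r = symm _ _ (↭ₚ.shift F P r)

  degXProdY-expand : ∀ P b es → AllNP P → length P ℕ.+ length (b ∷ es) ≡ d →
    degXProdY P (b ∷ es) ≡ sumℚ (map (λ G → degXProdY (G ∷ P) es) (separatingFlats (suc b) zero))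
  degXProdY-expand P b es np len = begin
    degXProdY P (b ∷ es)
      ≡⟨ sumℚ-concatMap (λ r → φ (P ++ r)) (λ F → map (F ∷_) R) (yFlats b) ⟩
    sumℚ (map (λ F → sumℚ (map (λ r → φ (P ++ r)) (map (F ∷_) R))) (yFlats b))
      ≡⟨ sumℚ-map-cong (yFlats b) (λ {F} _ → cong sumℚ (trans (sym (Listₚ.map-∘ R))
                                                (Listₚ.map-cong (φ-++-∷ P F) R))) ⟩
    sumℚ (map (λ F → sumℚ (map (λ r → φ (F ∷ P ++ r)) R)) (yFlats b))
      ≡⟨ sumℚ-map-comm (λ F r → φ (F ∷ P ++ r)) (yFlats b) R ⟩
    sumℚ (map (λ r → sumℚ (map (λ F → φ (F ∷ P ++ r)) (yFlats b))) R)
      ≡⟨ sumℚ-map-cong R (λ r∈ → linear-separating (P ++ _) (Allₚ.++⁺ np (choice-NP es r∈))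
                                    (suc-length-++-choice P {b} es len r∈) λ ()) ⟩
    sumℚ (map (λ r → sumℚ (map (λ G → φ (G ∷ P ++ r)) (separatingFlats (suc b) zero))) R)
      ≡⟨ sumℚ-map-comm (λ G r → φ (G ∷ P ++ r)) (separatingFlats (suc b) zero) R ⟨
    sumℚ (map (λ G → degXProdY (G ∷ P) es) (separatingFlats (suc b) zero)) ∎
    where
    open ≡-Reasoning
    R : List Monomial
    R = choices (map yFlats es)

  -- The flat at the end of a chain stored latest-first; the empty chain ends at ⊥.
  top : Monomial → Subset (suc n)
  top []      = ⊥
  top (G ∷ _) = G

  top-∈ : ∀ P → top P ≡ ⊥ ⊎ top P ∈ˡ P
  top-∈ []      = inj₁ refl
  top-∈ (G ∷ P) = inj₂ (here refl)

  Admissible : Monomial → List (Fin n) → Subset (suc n) → Set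
  Admissible P es G = top P ⊆ G × All (λ e → suc e ∉ G) es

  admissible? : ∀ P es → Decidable (Admissible P es)
  admissible? P es G = (top P Subsetₚ.⊆? G) ×-dec All.all? (λ e → ¬? (suc e Subsetₚ.∈? G)) es

  degXProdY-inadmissible : ∀ P b es {G} → AllNP P → length P ℕ.+ length (b ∷ es) ≡ d → suc b ∉ top P →
    G ∈ˡ separatingFlats (suc b) zero → ¬ Admissible P es G → degXProdY (G ∷ P) es ≡ 0ℚ
  degXProdY-inadmissible P b es {G} np len b∉top G∈ ¬admissible = sumℚ-map-zero R vanishes
    where
    R : List Monomial
    R = choices (map yFlats es)
    b∈G : suc b ∈ G
    b∈G = proj₁ (proj₂ (∈-separatingFlats⁻ G∈))
    zero∉G : zero ∉ G
    zero∉G = proj₂ (proj₂ (∈-separatingFlats⁻ G∈))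
    incomparable : ∀ {r} → r ∈ˡ R → ∃ λ H → H ∈ˡ P ++ r × ¬ G ⊆ H × ¬ H ⊆ G
    incomparable r∈ with top P Subsetₚ.⊆? G | top-∈ P
    ... | no top⊈G | inj₁ top≡⊥ =
      ⊥-elim (top⊈G λ x∈top → contradiction (subst (_ ∈_) top≡⊥ x∈top) Subsetₚ.∉⊥)
    ... | no top⊈G | inj₂ top∈P = top P , ∈ˡₚ.∈-++⁺ˡ top∈P , ∈∉⇒⊈ b∈G b∉top , top⊈G
    ... | yes top⊆G | _ =
      let e , e∈es , ¬e∉G =
            find (Allₚ.¬All⇒Any¬ (λ e → ¬? (suc e Subsetₚ.∈? G)) es (¬admissible ∘ (top⊆G ,_)))
          e∈G = decidable-stable (suc e Subsetₚ.∈? G) ¬e∉G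
          F , F∈r , F∈yFlats = choices-meets (map yFlats es) (∈ˡₚ.∈-map⁺ yFlats e∈es) r∈
          _ , zero∈F , e∉F = ∈-separatingFlats⁻ F∈yFlats
      in F , ∈ˡₚ.∈-++⁺ʳ P F∈r , ∈∉⇒⊈ e∈G e∉F , ∈∉⇒⊈ zero∈F zero∉G
    vanishes : ∀ {r} → r ∈ˡ R → φ (G ∷ P ++ r) ≡ 0ℚ
    vanishes r∈ =
      let H , H∈ , G⊈H , H⊈G = incomparable r∈
      in φ-incomparable (P ++ _) H∈ (All.lookup separatingFlats-NP G∈ ∷ Allₚ.++⁺ np (choice-NP es r∈))
           (suc-length-++-choice P {b} es len r∈) G⊈H H⊈G

  degXProdY-step : ∀ P b es → AllNP P → length P ℕ.+ length (b ∷ es) ≡ d → suc b ∉ top P →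
    degXProdY P (b ∷ es) ≡
    sumℚ (map (λ G → degXProdY (G ∷ P) es) (filter (admissible? P es) (separatingFlats (suc b) zero)))
  degXProdY-step P b es np len b∉top = trans (degXProdY-expand P b es np len)
    (sumℚ-filter-vanishing (admissible? P es) _ (separatingFlats (suc b) zero)
      (degXProdY-inadmissible P b es np len b∉top))

  ∷-decreasing : ∀ {G} P → top P ⊂ G → Linked _⊃_ P → Linked _⊃_ (G ∷ P)
  ∷-decreasing []      _     _   = [-]
  ∷-decreasing (H ∷ P) H⊂G decr = H⊂G ∷ decr

-- Evaluating ∏_{e ∈ B} y_e

module Evaluation {n : ℕ} (M : Matroid n) (d : ℕ) (φ : List (Subset (suc n)) → ℚ)
                  (isDeg : ChowRing.IsDeg M d φ) (loopless : Loopless M)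
                  (rank≡d : rankOf (indep M) ⊤ ≡ d) (B : Subset n) (∣B∣≡d : ∣ B ∣ ≡ d) where

  open ChowRing M using (AllNP; Monomial)
  open ChowRing.IsDeg isDeg using (symm; chain)
  open Expansion M d φ isDeg
  open MatroidProperties (addColoop M)

  lift : Subset n → Subset (suc n)
  lift A = outside ∷ A

  _≟ˢ_ : ∀ (S U : Subset (suc n)) → Dec (S ≡ U)
  _≟ˢ_ = Vecₚ.≡-dec Boolₚ._≟_

  -- P = G_k ⊃ ⋯ ⊃ G_1 is the chain of flats chosen for the elements A of B already
  -- processed; es lists the remaining elements of B.
  record Invariant (P : Monomial) (A : Subset n) (es : List (Fin n)) : Set where
    field
      allNP      : AllNP P
      length≡d   : length P ℕ.+ length es ≡ d
      decreasing : Linked _⊃_ P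
      top-flat   : Flat (top P)
      zero∉top   : zero ∉ top P
      lift⊆top   : lift A ⊆ top P
      A-indep    : T (indep M A)
      A⊆B        : A ⊆ B
      B⊆A∪es     : ∀ {x} → x ∈ B → x ∈ A ⊎ x ∈ˡ es
      es⊆B       : All (_∈ B) es
      es-unique  : Unique es
      top-avoids : All (λ e → suc e ∉ top P) es

  invariant-init : Invariant [] ⊥ (elements B)
  invariant-init = record
    { allNP      = []
    ; length≡d   = trans (length-elements B) ∣B∣≡d
    ; decreasing = []
    ; top-flat   = ⊥-flat (addColoop-loopless {M = M} loopless)
    ; zero∉top   = Subsetₚ.∉⊥
    ; lift⊆top   = λ x∈ → x∈
    ; A-indep    = indep-∅ M
    ; A⊆B        = Subsetₚ.⊥⊆
    ; B⊆A∪es     = λ x∈B → inj₂ (∈-select⁺ (∈ˡₚ.∈-allFin _) (∈⇒∈ᵇ x∈B))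
    ; es⊆B       = All.tabulate λ e∈ → ∈ᵇ⇒∈ (proj₂ (∈-select⁻ (_∈ᵇ B) (allFin n) e∈))
    ; es-unique  = Uniqueₚ.filter⁺ (T? ∘ (_∈ᵇ B)) (Uniqueₚ.allFin⁺ n)
    ; top-avoids = All.tabulate λ _ → Subsetₚ.∉⊥
    }

  module _ {P A b es} (inv : Invariant P A (b ∷ es)) where
    open Invariant inv

    lift∪b-indep : Indep (lift A ∪ ⁅ suc b ⁆)
    lift∪b-indep = flat-indep-∪ top-flat A-indep lift⊆top (All.head top-avoids)

    invariant-step : ∀ {G} → G ∈ˡ filter (admissible? P es) (separatingFlats (suc b) zero) →
                     Invariant (G ∷ P) (A ∪ ⁅ b ⁆) es
    invariant-step {G} G∈
      with G∈sep , top⊆G , G-avoids ←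
             ∈ˡₚ.∈-filter⁻ (admissible? P es) {xs = separatingFlats (suc b) zero} G∈
      with G-flat , b∈G , zero∉G ← ∈-separatingFlats⁻ G∈sep = record
      { allNP      = All.lookup separatingFlats-NP G∈sep ∷ allNP
      ; length≡d   = trans (sym (ℕₚ.+-suc (length P) (length es))) length≡d
      ; decreasing = ∷-decreasing P (top⊆G , suc b , b∈G , All.head top-avoids) decreasing
      ; top-flat   = G-flat
      ; zero∉top   = zero∉G
      ; lift⊆top   = ∪⁅⁆-⊆ (top⊆G ∘ lift⊆top) b∈G
      ; A-indep    = lift∪b-indep
      ; A⊆B        = ∪⁅⁆-⊆ A⊆B (All.head es⊆B)
      ; B⊆A∪es     = B⊆A∪b∪es
      ; es⊆B       = All.tail es⊆B
      ; es-unique  = AllPairs.tail es-unique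
      ; top-avoids = G-avoids
      }
      where
      B⊆A∪b∪es : ∀ {x} → x ∈ B → x ∈ A ∪ ⁅ b ⁆ ⊎ x ∈ˡ es
      B⊆A∪b∪es x∈B with B⊆A∪es x∈B
      ... | inj₁ x∈A          = inj₁ (p⊆p∪⁅x⁆ b x∈A)
      ... | inj₂ (here refl)  = inj₁ (x∈p∪⁅x⁆ A b)
      ... | inj₂ (there x∈es) = inj₂ x∈es

    G₀ : Subset (suc n)
    G₀ = cl (lift A ∪ ⁅ suc b ⁆)

    G₀-separating : T (separating (suc b) zero G₀)
    G₀-separating = separating⁺ (cl-flat lift∪b-indep) (⊆-cl (x∈p∪⁅x⁆ (lift A) (suc b))) zero∉G₀
      where
      zero∉G₀ : zero ∉ G₀
      zero∉G₀ zero∈G₀ with ∈-cl⁻ zero∈G₀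
      ... | inj₁ ()
      ... | inj₂ dep = dep (indepBar-∪-zero (indep M) {lift A ∪ ⁅ suc b ⁆} lift∪b-indep)

    top≡cl⇒admissible : IsBasis M B → top P ≡ cl (lift A) → Admissible P es G₀
    top≡cl⇒admissible (B-indep , _) top≡cl =
      subst (_⊆ G₀) (sym top≡cl) (cl-least (cl-flat lift∪b-indep) A-indep (⊆-cl ∘ p⊆p∪⁅x⁆ (suc b))) ,
      All.tabulate avoids
      where
      avoids : ∀ {e} → e ∈ˡ es → suc e ∉ G₀
      avoids {e} e∈es e∈G₀ with ∈-cl⁻ e∈G₀
      ... | inj₂ dep = dep (indep-⊆ M B _ A∪b∪e⊆B B-indep)
        where
        A∪b∪e⊆B : (A ∪ ⁅ b ⁆) ∪ ⁅ e ⁆ ⊆ B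
        A∪b∪e⊆B = ∪⁅⁆-⊆ (∪⁅⁆-⊆ A⊆B (All.head es⊆B)) (All.lookup (All.tail es⊆B) e∈es)
      ... | inj₁ e∈A∪b with x∈p∪⁅y⁆⁻ (lift A) (suc b) e∈A∪b
      ...   | inj₁ e∈A  = All.lookup (All.tail top-avoids) e∈es (lift⊆top e∈A)
      ...   | inj₂ e≡b  = All.lookup (AllPairs.head es-unique) e∈es (sym (Finₚ.suc-injective e≡b))

    admissible⇒top≡cl : Admissible P es G₀ → top P ≡ cl (lift A)
    admissible⇒top≡cl (top⊆G₀ , _) = Subsetₚ.⊆-antisym top⊆cl (cl-least top-flat A-indep lift⊆top)
      where
      top⊆cl : top P ⊆ cl (lift A)
      top⊆cl {x} x∈top with x Subsetₚ.∈? cl (lift A)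
      ... | yes x∈cl = x∈cl
      ... | no x∉cl with iAx , x∉A ← ∉-cl⁻ x∉cl with ∈-cl⁻ (top⊆G₀ x∈top)
      ...   | inj₂ dep = contradiction
                (indep-⊆ (addColoop M) _ _ (∪⁅⁆-swap (lift A) (suc b) x)
                  (flat-indep-∪ top-flat iAx (∪⁅⁆-⊆ lift⊆top x∈top) (All.head top-avoids)))
                dep
      ...   | inj₁ x∈A∪b with x∈p∪⁅y⁆⁻ (lift A) (suc b) x∈A∪b
      ...     | inj₁ x∈A  = contradiction x∈A x∉A
      ...     | inj₂ refl = contradiction x∈top (All.head top-avoids)

  module _ {P A} (inv : Invariant P A []) where
    open Invariant inv

    B⊆A : B ⊆ A
    B⊆A x∈B with B⊆A∪es x∈B
    ... | inj₁ x∈A = x∈A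

    invariant-basis : IsBasis M B
    invariant-basis = MatroidProperties.indep-of-full-rank⇒basis M
      (indep-⊆ M A B B⊆A A-indep) (trans ∣B∣≡d (sym rank≡d))

    top≡cl : IsBasis M B → top P ≡ cl (lift A)
    top≡cl (_ , B-maximal) = Subsetₚ.⊆-antisym top⊆cl (cl-least top-flat A-indep lift⊆top)
      where
      top⊆cl : top P ⊆ cl (lift A)
      top⊆cl {zero}  zero∈top = contradiction zero∈top zero∉top
      top⊆cl {suc y} y∈top with suc y Subsetₚ.∈? cl (lift A)
      ... | yes y∈cl = y∈cl
      ... | no y∉cl with iAy , y∉A ← ∉-cl⁻ y∉cl =
        ⊥-elim (B-maximal y (y∉A ∘ there ∘ B⊆A)
                  (indep-⊆ M (A ∪ ⁅ y ⁆) (B ∪ ⁅ y ⁆) (∪⁅⁆-⊆ (p⊆p∪⁅x⁆ y ∘ B⊆A) (x∈p∪⁅x⁆ A y)) iAy))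

  degXProdY-nonbasis : ¬ IsBasis M B → ∀ {P A} es → Invariant P A es → degXProdY P es ≡ 0ℚ
  degXProdY-nonbasis ¬basis []       inv = contradiction (invariant-basis inv) ¬basis
  degXProdY-nonbasis ¬basis {P} (b ∷ es) inv =
    trans (degXProdY-step P b es allNP length≡d (All.head top-avoids))
          (sumℚ-map-zero _ λ G∈ → degXProdY-nonbasis ¬basis es (invariant-step inv G∈))
    where open Invariant inv

  degXProdY-basis : IsBasis M B → ∀ {P A} es → Invariant P A es →
                    degXProdY P es ≡ indicator (top P ≟ˢ cl (lift A))
  degXProdY-basis basis {P} {A} [] inv = begin
    φ (P ++ []) + 0ℚ ≡⟨ ℚₚ.+-identityʳ _ ⟩
    φ (P ++ [])      ≡⟨ cong φ (Listₚ.++-identityʳ P) ⟩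
    φ P              ≡⟨ symm _ _ (↭ₚ.↭-reverse P) ⟨
    φ (reverse P)    ≡⟨ chain (reverse P) (↭ₚ.All-resp-↭ (↭-sym (↭ₚ.↭-reverse P)) allNP)
                              (trans (Listₚ.length-reverse P) (trans (sym (ℕₚ.+-identityʳ _)) length≡d))
                              (Linked-reverse⁺ decreasing) ⟩
    1ℚ               ≡⟨ indicator-yes (top P ≟ˢ cl (lift A)) (top≡cl inv basis) ⟨
    indicator (top P ≟ˢ cl (lift A)) ∎
    where
    open ≡-Reasoning
    open Invariant inv
  degXProdY-basis basis {P} {A} (b ∷ es) inv = begin
    degXProdY P (b ∷ es)
      ≡⟨ degXProdY-step P b es allNP length≡d (All.head top-avoids) ⟩
    sumℚ (map (λ G → degXProdY (G ∷ P) es) (filter (admissible? P es) (separatingFlats (suc b) zero)))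
      ≡⟨ sumℚ-filter-select-supported (separating (suc b) zero) (admissible? P es) _ (G₀ inv)
           (G₀-separating inv) vanishes ⟩
    (if does (admissible? P es (G₀ inv)) then degXProdY (G₀ inv ∷ P) es else 0ℚ)
      ≡⟨ at-G₀ (admissible? P es (G₀ inv)) ⟩
    indicator (top P ≟ˢ cl (lift A)) ∎
    where
    open ≡-Reasoning
    open Invariant inv
    degXProdY-admissible : ∀ {G} → G ∈ˡ filter (admissible? P es) (separatingFlats (suc b) zero) →
                           degXProdY (G ∷ P) es ≡ indicator (G ≟ˢ G₀ inv)
    degXProdY-admissible G∈ = degXProdY-basis basis es (invariant-step inv G∈)
    vanishes : ∀ {G} → G ∈ˡ filter (admissible? P es) (separatingFlats (suc b) zero) → G ≢ G₀ inv →
               degXProdY (G ∷ P) es ≡ 0ℚ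
    vanishes {G} G∈ G≢G₀ = trans (degXProdY-admissible G∈) (indicator-no (G ≟ˢ G₀ inv) G≢G₀)
    at-G₀ : (adm? : Dec (Admissible P es (G₀ inv))) →
            (if does adm? then degXProdY (G₀ inv ∷ P) es else 0ℚ) ≡ indicator (top P ≟ˢ cl (lift A))
    at-G₀ (yes adm) = begin
      degXProdY (G₀ inv ∷ P) es ≡⟨ degXProdY-admissible G₀∈ ⟩
      indicator (G₀ inv ≟ˢ G₀ inv) ≡⟨ indicator-yes (G₀ inv ≟ˢ G₀ inv) refl ⟩
      1ℚ ≡⟨ indicator-yes (top P ≟ˢ cl (lift A)) (admissible⇒top≡cl inv adm) ⟨
      indicator (top P ≟ˢ cl (lift A)) ∎
      where
      G₀∈ : G₀ inv ∈ˡ filter (admissible? P es) (separatingFlats (suc b) zero)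
      G₀∈ = ∈ˡₚ.∈-filter⁺ (admissible? P es)
              (∈-select⁺ (∈-allSubsets (suc n) (G₀ inv)) (G₀-separating inv)) adm
    at-G₀ (no ¬adm) = sym (indicator-no (top P ≟ˢ cl (lift A)) (¬adm ∘ top≡cl⇒admissible inv basis))

lemma3p2 : ∀ {n} (M : Matroid n) (d : ℕ) → Loopless M → rankOf (indep M) ⊤ ≡ d →
           (B : Subset n) → ∣ B ∣ ≡ d →
           (φ : List (Subset (suc n)) → ℚ) → ChowRing.IsDeg M d φ →
           (IsBasis M B → ChowRing.degProdY M φ B ≡ 1ℚ) ×
           (¬ IsBasis M B → ChowRing.degProdY M φ B ≡ 0ℚ)
lemma3p2 M d loopless rank≡d B ∣B∣≡d φ isDeg =
  (λ basis → trans (degXProdY-basis basis (elements B) invariant-init)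
                   (indicator-yes (⊥ ≟ˢ cl ⊥) (sym (cl-⊥ (addColoop-loopless {M = M} loopless))))) ,
  (λ ¬basis → degXProdY-nonbasis ¬basis (elements B) invariant-init)
  where
  open Evaluation M d φ isDeg loopless rank≡d B ∣B∣≡d
  open MatroidProperties (addColoop M) using (cl; cl-⊥)
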